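{- Let $t\ge 2$ and $n\ge t+1$ be integers, $N=n-t$, and let $\Delta:[1-t,n-t]\to\{0,1\}$ be a $2$-coloring. Let $a=|\Delta^{ -1}(0)\cap[1-t,-1]|$, $q=|\Delta^{ -1}(0)\cap[1,N]|$, and let $\varepsilon=1$ if $\Delta(0)=0$ and $\varepsilon=0$ otherwise. Let $N_{QPP}$ be the number of triples $(x_1,x_2,x_3)$ with $x_1\in[1-t,0]$, $x_2,x_3\in[1,N]$, $x_1\le x_2\le x_3$, $x_1+x_2<x_3$ and $\Delta(x_1)=\Delta(x_2)=\Delta(x_3)$. Then \[ N_{QPP}=a\binom{q+1}{2}+(t-1-a)\binom{N-q+1}{2}+\varepsilon\binom{q}{2}+(1-\varepsilon)\binom{N-q}{2}. \]
   Context: For integers $a\le b$, $[a,b]=\{m\in\mathbb Z:a\le m\le b\}$. -}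

module Defs where

open import Data.Nat using (ℕ; zero; suc)
open import Data.Integer using (ℤ; +_; -[1+_]; _+_; _-_; _≤?_; _<?_)
open import Data.Integer.Properties using (_≟_)
open import Data.Fin using (Fin)
import Data.Fin as Fin
open import Data.List using (List; []; _∷_; map; concatMap; filter; length; upTo)
open import Data.Product using (_×_; _,_)
open import Relation.Nullary.Decidable using (_×-dec_)
open import Relation.Binary.PropositionalEquality using (_≡_)

trunc : ℤ → ℕ
trunc (+ n) = n
trunc -[1+ n ] = 0

-- the integer interval [a,b] = {m ∈ ℤ : a ≤ m ≤ b}, listed increasingly (empty if b < a)
[_,_] : ℤ → ℤ → List ℤ
[ a , b ] = map (λ i → a + + i) (upTo (trunc ((b + + 1) - a)))

-- a 2-coloring (only its values on the relevant interval matter)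
Coloring : Set
Coloring = ℤ → Fin 2

count0 : Coloring → List ℤ → ℕ
count0 Δ xs = length (filter (λ x → Δ x Fin.≟ Fin.zero) xs)

QPP : Coloring → ℤ × ℤ × ℤ → Set
QPP Δ (x₁ , x₂ , x₃) =
  (x₁ Data.Integer.≤ x₂) × (x₂ Data.Integer.≤ x₃) × (x₁ + x₂ Data.Integer.< x₃)
  × (Δ x₁ ≡ Δ x₂) × (Δ x₂ ≡ Δ x₃)

QPP? : (Δ : Coloring) → (p : ℤ × ℤ × ℤ) → Relation.Nullary.Decidable.Dec (QPP Δ p)
QPP? Δ (x₁ , x₂ , x₃) =
  (x₁ ≤? x₂) ×-dec (x₂ ≤? x₃) ×-dec (x₁ + x₂ <? x₃)
  ×-dec (Δ x₁ Fin.≟ Δ x₂) ×-dec (Δ x₂ Fin.≟ Δ x₃)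

triples : List ℤ → List ℤ → List ℤ → List (ℤ × ℤ × ℤ)
triples I₁ I₂ I₃ = concatMap (λ x₁ → concatMap (λ x₂ → map (λ x₃ → (x₁ , x₂ , x₃)) I₃) I₂) I₁

NQPP : (t N : ℕ) → Coloring → ℕ
NQPP t N Δ = length (filter (QPP? Δ)
  (triples [ + 1 - + t , + 0 ] [ + 1 , + N ] [ + 1 , + N ]))

eps : Coloring → ℕ
eps Δ with Δ (+ 0) Fin.≟ Fin.zero
... | Relation.Nullary.Decidable.yes _ = 1
... | Relation.Nullary.Decidable.no _ = 0

-- For x₁ < 0 and x₂, x₃ ≥ 1, the conditions x₁ ≤ x₂ and x₁ + x₂ < x₃ are implied by x₂ ≤ x₃, so x₁
-- contributes the number of pairs x₂ ≤ x₃ in [1, N] of colour Δ(x₁); these lie in the sublist of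
-- that colour, which is strictly increasing, so with k points there are C(k + 1, 2) of them. For
-- x₁ = 0 the conditions collapse to x₂ < x₃, giving C(k, 2). Summing over x₁ ∈ [1 - t, -1] by colour
-- yields the first two terms, and x₁ = 0 the last two.
module Submission where

open import Defs
open import Data.Nat using (ℕ; _+_; _*_; _∸_; _≤_)
open import Data.Nat.Combinatorics using (_C_)
open import Data.Integer using (+_; -[1+_])
import Data.Integer as ℤ
open import Relation.Binary.PropositionalEquality using (_≡_)

open import Data.Fin using (Fin; zero; suc)
import Data.Fin as Fin
import Data.Integer.Properties as ℤₚ
open import Data.Integer.Tactic.RingSolver using (solve-∀)
open import Data.List using (List; []; _∷_; _++_; _∷ʳ_; map; concatMap; filter; length; upTo)
open import Data.List.Properties
  using (filter-++; filter-≐; filter-all; filter-none; filter-reject; length-++; length-map; length-upTo;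
         map-++; map-cong; map-cong-local; upTo-∷ʳ)
open import Data.List.Relation.Unary.All as All using (All; []; _∷_)
import Data.List.Relation.Unary.All.Properties as All
open import Data.List.Relation.Unary.AllPairs using (AllPairs; []; _∷_)
import Data.List.Relation.Unary.AllPairs.Properties as AllPairs
open import Data.Nat using (zero; suc; _<_; s≤s; z≤n)
open import Data.Nat.Combinatorics using (nC1≡n; nCk+nC[k+1]≡[n+1]C[k+1])
open import Data.Nat.ListAction using (sum)
open import Data.Nat.ListAction.Properties using (sum-++)
import Data.Nat.Properties as ℕₚ
open import Algebra.Properties.CommutativeSemigroup ℕₚ.+-commutativeSemigroup using (interchange; x∙yz≈y∙xz)
open import Data.Product using (_×_; _,_; proj₁; proj₂)
open import Function using (_∘_; id)
open import Level using (0ℓ)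
open import Relation.Binary using (Rel; Decidable)
open import Relation.Binary.PropositionalEquality
  using (refl; sym; trans; cong; cong₂; subst; module ≡-Reasoning)
open import Relation.Nullary using (yes; no; ¬_; contradiction)
open import Relation.Nullary.Decidable using (_×-dec_)
import Relation.Unary as U
open import Relation.Unary using (Pred; _≐_)
open import Relation.Unary.Properties using (_∩?_)

count : {A : Set} {P : Pred A 0ℓ} → U.Decidable P → List A → ℕ
count P? xs = length (filter P? xs)

module _ {A : Set} {P : Pred A 0ℓ} (P? : U.Decidable P) where

  count-++ : ∀ xs ys → count P? (xs ++ ys) ≡ count P? xs + count P? ys
  count-++ xs ys = trans (cong length (filter-++ P? xs ys)) (length-++ (filter P? xs))

  count-concatMap : {B : Set} (f : B → List A) (xs : List B) →
                    count P? (concatMap f xs) ≡ sum (map (count P? ∘ f) xs)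
  count-concatMap f []       = refl
  count-concatMap f (x ∷ xs) =
    trans (count-++ (f x) (concatMap f xs)) (cong (_+_ (count P? (f x))) (count-concatMap f xs))

  count-map : {B : Set} (f : B → A) (xs : List B) → count P? (map f xs) ≡ count (P? ∘ f) xs
  count-map f []       = refl
  count-map f (x ∷ xs) with P? (f x)
  ... | yes _ = cong suc (count-map f xs)
  ... | no _  = count-map f xs

  count-≐ : {Q : Pred A 0ℓ} (Q? : U.Decidable Q) → P ≐ Q → ∀ xs → count P? xs ≡ count Q? xs
  count-≐ Q? P≐Q xs = cong length (filter-≐ P? Q? P≐Q xs)

  count-filter : {Q : Pred A 0ℓ} (Q? : U.Decidable Q) → ∀ xs → count P? (filter Q? xs) ≡ count (P? ∩? Q?) xs
  count-filter Q? []       = refl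
  count-filter Q? (x ∷ xs) with Q? x
  ... | no _ with P? x
  ...   | yes _ = count-filter Q? xs
  ...   | no _  = count-filter Q? xs
  count-filter Q? (x ∷ xs) | yes _ with P? x
  ...   | yes _ = cong suc (count-filter Q? xs)
  ...   | no _  = count-filter Q? xs

  sum-map-filter : (f : A → ℕ) → (∀ {x} → ¬ P x → f x ≡ 0) →
                   ∀ xs → sum (map f xs) ≡ sum (map f (filter P? xs))
  sum-map-filter f f≡0 []       = refl
  sum-map-filter f f≡0 (x ∷ xs) with P? x
  ... | yes _  = cong (_+_ (f x)) (sum-map-filter f f≡0 xs)
  ... | no ¬px = trans (cong (_+ sum (map f xs)) (f≡0 ¬px)) (sum-map-filter f f≡0 xs)

sum-map-∷ʳ : {A : Set} (f : A → ℕ) (xs : List A) (x : A) → sum (map f (xs ∷ʳ x)) ≡ sum (map f xs) + f x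
sum-map-∷ʳ f xs x = begin
  sum (map f (xs ∷ʳ x))       ≡⟨ cong sum (map-++ f xs (x ∷ [])) ⟩
  sum (map f xs ++ f x ∷ [])  ≡⟨ sum-++ (map f xs) (f x ∷ []) ⟩
  sum (map f xs) + (f x + 0)  ≡⟨ cong (_+_ (sum (map f xs))) (ℕₚ.+-identityʳ (f x)) ⟩
  sum (map f xs) + f x        ∎
  where open ≡-Reasoning

n+nC2≡[1+n]C2 : ∀ n → n + n C 2 ≡ suc n C 2
n+nC2≡[1+n]C2 n = trans (cong (_+ n C 2) (sym (nC1≡n n))) (nCk+nC[k+1]≡[n+1]C[k+1] n 1)

pairCount : {A : Set} {R : Rel A 0ℓ} → Decidable R → List A → ℕ
pairCount R? xs = sum (map (λ x → count (R? x) xs) xs)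

pairCount-cong : {A : Set} {R S : Rel A 0ℓ} (R? : Decidable R) (S? : Decidable S) {xs : List A} →
                 All (λ x → R x ≐ S x) xs → pairCount R? xs ≡ pairCount S? xs
pairCount-cong R? S? {xs} R≐S =
  cong sum (map-cong-local (All.map (λ {x} Rx≐Sx → count-≐ (R? x) (S? x) Rx≐Sx xs) R≐S))

pairCount-filter : {A : Set} {R : Rel A 0ℓ} {P : Pred A 0ℓ} (R? : Decidable R) (P? : U.Decidable P) →
                   ∀ xs → pairCount (λ x y → R? x y ×-dec (P? x ×-dec P? y)) xs ≡ pairCount R? (filter P? xs)
pairCount-filter {A} {R} {P} R? P? xs = begin
  sum (map row xs)              ≡⟨ sum-map-filter P? row row-off xs ⟩
  sum (map row (filter P? xs))  ≡⟨ cong sum (map-cong-local (All.map row-on (All.all-filter P? xs))) ⟩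
  pairCount R? (filter P? xs)   ∎
  where
  open ≡-Reasoning
  row : A → ℕ
  row x = count (λ y → R? x y ×-dec (P? x ×-dec P? y)) xs
  row-off : ∀ {x} → ¬ P x → row x ≡ 0
  row-off ¬px = cong length (filter-none _ (All.universal (λ _ → ¬px ∘ proj₁ ∘ proj₂) xs))
  row-on : ∀ {x} → P x → row x ≡ count (R? x) (filter P? xs)
  row-on {x} px = trans (count-≐ _ (R? x ∩? P?) (drop-Px , add-Px) xs) (sym (count-filter (R? x) P? xs))
    where
    drop-Px : ∀ {y} → R x y × P x × P y → R x y × P y
    drop-Px (r , _ , py) = r , py
    add-Px : ∀ {y} → R x y × P y → R x y × P x × P y
    add-Px (r , py) = r , px , py

module _ {A : Set} {_≺_ R : Rel A 0ℓ} (R? : Decidable R)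
         (≺⇒R : ∀ {x y} → x ≺ y → R x y) (≺⇒¬R˘ : ∀ {x y} → x ≺ y → ¬ R y x) where

  pairCount-sorted : ∀ {xs} → AllPairs _≺_ xs → pairCount R? xs ≡ count (λ x → R? x x) xs + length xs C 2
  pairCount-sorted {[]}     []              = refl
  pairCount-sorted {y ∷ ys} (y≺ys ∷ sorted) = begin
    count (R? y) (y ∷ ys) + sum (map (λ z → count (R? z) (y ∷ ys)) ys)
      ≡⟨ cong₂ _+_ first-row other-rows ⟩
    (d + L) + (D + L C 2)
      ≡⟨ interchange d L D (L C 2) ⟩
    (d + D) + (L + L C 2)
      ≡⟨ cong₂ _+_ (sym (count-++ (λ x → R? x x) (y ∷ []) ys)) (n+nC2≡[1+n]C2 L) ⟩
    count (λ x → R? x x) (y ∷ ys) + suc L C 2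
      ∎
    where
    open ≡-Reasoning
    L d D : ℕ
    L = length ys
    d = count (λ x → R? x x) (y ∷ [])
    D = count (λ x → R? x x) ys
    diagonal : count (R? y) (y ∷ []) ≡ d
    diagonal with R? y y
    ... | yes _ = refl
    ... | no _  = refl
    first-row : count (R? y) (y ∷ ys) ≡ d + L
    first-row = trans (count-++ (R? y) (y ∷ []) ys)
                      (cong₂ _+_ diagonal (cong length (filter-all (R? y) (All.map ≺⇒R y≺ys))))
    other-rows : sum (map (λ z → count (R? z) (y ∷ ys)) ys) ≡ D + L C 2
    other-rows = trans (cong sum (map-cong-local (All.map (cong length ∘ filter-reject (R? _) ∘ ≺⇒¬R˘) y≺ys)))
                       (pairCount-sorted sorted)

pairCount-≤ : ∀ {xs} → AllPairs ℤ._<_ xs → pairCount ℤ._≤?_ xs ≡ (length xs + 1) C 2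
pairCount-≤ {xs} sorted = begin
  pairCount ℤ._≤?_ xs                        ≡⟨ pairCount-sorted ℤ._≤?_ ℤₚ.<⇒≤ ℤₚ.<⇒≱ sorted ⟩
  count (λ x → x ℤ.≤? x) xs + length xs C 2  ≡⟨ cong (λ ys → length ys + length xs C 2)
                                                     (filter-all _ (All.universal (λ _ → ℤₚ.≤-refl) xs)) ⟩
  length xs + length xs C 2                  ≡⟨ n+nC2≡[1+n]C2 (length xs) ⟩
  suc (length xs) C 2                        ≡⟨ cong (_C 2) (ℕₚ.+-comm 1 (length xs)) ⟩
  (length xs + 1) C 2                        ∎
  where open ≡-Reasoning

pairCount-< : ∀ {xs} → AllPairs ℤ._<_ xs → pairCount ℤ._<?_ xs ≡ length xs C 2
pairCount-< {xs} sorted =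
  trans (pairCount-sorted ℤ._<?_ id ℤₚ.<-asym sorted)
        (cong (λ ys → length ys + length xs C 2) (filter-none _ (All.universal (λ _ → ℤₚ.<-irrefl refl) xs)))

j+[i-j]≡i : ∀ i j → j ℤ.+ (i ℤ.- j) ≡ i
j+[i-j]≡i = solve-∀

[i+1]-j≡1+[i-j] : ∀ i j → (i ℤ.+ + 1) ℤ.- j ≡ + 1 ℤ.+ (i ℤ.- j)
[i+1]-j≡1+[i-j] = solve-∀

i+1-1≡i : ∀ i → (i ℤ.+ + 1) ℤ.- + 1 ≡ i
i+1-1≡i = solve-∀

[,]-sorted : ∀ a b → AllPairs ℤ._<_ [ a , b ]
[,]-sorted a b = AllPairs.map⁺ (AllPairs.applyUpTo⁺₁ id _ (λ i<j _ → ℤₚ.+-monoʳ-< a (ℤ.+<+ i<j)))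

[,]-lower : ∀ a b → All (a ℤ.≤_) [ a , b ]
[,]-lower a b = All.map⁺ (All.universal (λ i → ℤₚ.i≤i+j a (+ i)) _)

[,]-upper : ∀ a b → All (ℤ._≤ b) [ a , b ]
[,]-upper a b with (b ℤ.+ + 1) ℤ.- a in eq
... | -[1+ _ ] = []
... | + k      = All.map⁺ (All.applyUpTo⁺₁ id k a+i≤b)
  where
  a+k≡1+b : a ℤ.+ + k ≡ ℤ.suc b
  a+k≡1+b = trans (trans (cong (ℤ._+_ a) (sym eq)) (j+[i-j]≡i _ a)) (ℤₚ.+-comm b (+ 1))
  a+i≤b : ∀ {i} → i < k → a ℤ.+ + i ℤ.≤ b
  a+i≤b {i} i<k = subst (a ℤ.+ + i ℤ.≤_) (ℤₚ.pred-suc b)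
    (ℤₚ.i<j⇒i≤pred[j] (subst (a ℤ.+ + i ℤ.<_) a+k≡1+b (ℤₚ.+-monoʳ-< a (ℤ.+<+ i<k))))

[,]-∷ʳ : ∀ a b → a ℤ.≤ b ℤ.+ + 1 → [ a , b ] ∷ʳ (b ℤ.+ + 1) ≡ [ a , b ℤ.+ + 1 ]
[,]-∷ʳ a b a≤b+1 with (b ℤ.+ + 1) ℤ.- a in eq
... | -[1+ _ ] = contradiction (subst (+ 0 ℤ.≤_) eq (ℤₚ.i≤j⇒0≤j-i a≤b+1)) λ ()
... | + k      = begin
  map g (upTo k) ∷ʳ (b ℤ.+ + 1)  ≡⟨ cong (map g (upTo k) ∷ʳ_) a+k≡b+1 ⟨
  map g (upTo k) ∷ʳ g k          ≡⟨ map-++ g (upTo k) (k ∷ []) ⟨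
  map g (upTo k ∷ʳ k)            ≡⟨ cong (map g) (upTo-∷ʳ k) ⟩
  map g (upTo (suc k))           ≡⟨ cong (map g ∘ upTo ∘ trunc) next-length ⟨
  [ a , b ℤ.+ + 1 ]              ∎
  where
  open ≡-Reasoning
  g : ℕ → ℤ.ℤ
  g i = a ℤ.+ + i
  a+k≡b+1 : a ℤ.+ + k ≡ b ℤ.+ + 1
  a+k≡b+1 = trans (cong (ℤ._+_ a) (sym eq)) (j+[i-j]≡i _ a)
  next-length : ((b ℤ.+ + 1) ℤ.+ + 1) ℤ.- a ≡ + suc k
  next-length = trans ([i+1]-j≡1+[i-j] (b ℤ.+ + 1) a) (cong (ℤ._+_ (+ 1)) eq)

length-[,] : ∀ a b {k} → (b ℤ.+ + 1) ℤ.- a ≡ + k → length [ a , b ] ≡ k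
length-[,] a b eq = trans (length-map (λ i → a ℤ.+ + i) (upTo m)) (trans (length-upTo m) (cong trunc eq))
  where
  m : ℕ
  m = trunc ((b ℤ.+ + 1) ℤ.- a)

colourCount : {A : Set} {k : ℕ} → (A → Fin k) → Fin k → List A → ℕ
colourCount χ c = count (λ x → χ x Fin.≟ c)

module _ {A : Set} (χ : A → Fin 2) where

  colourCount-partition : ∀ xs → colourCount χ zero xs + colourCount χ (suc zero) xs ≡ length xs
  colourCount-partition []       = refl
  colourCount-partition (x ∷ xs) with χ x
  ... | zero     = cong suc (colourCount-partition xs)
  ... | suc zero = trans (ℕₚ.+-suc _ _) (cong suc (colourCount-partition xs))

  colourCount-one : ∀ xs → colourCount χ (suc zero) xs ≡ length xs ∸ colourCount χ zero xs
  colourCount-one xs = trans (sym (ℕₚ.m+n∸m≡n (colourCount χ zero xs) _))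
                             (cong (_∸ colourCount χ zero xs) (colourCount-partition xs))

  sum-map-colour : (f : Fin 2 → ℕ) → ∀ xs → sum (map (f ∘ χ) xs)
                   ≡ colourCount χ zero xs * f zero + colourCount χ (suc zero) xs * f (suc zero)
  sum-map-colour f []       = refl
  sum-map-colour f (x ∷ xs) with χ x
  ... | zero     = trans (cong (_+_ (f zero)) (sum-map-colour f xs)) (sym (ℕₚ.+-assoc (f zero) _ _))
  ... | suc zero = trans (cong (_+_ (f (suc zero))) (sum-map-colour f xs))
                         (x∙yz≈y∙xz (f (suc zero)) (colourCount χ zero xs * f zero)
                                                   (colourCount χ (suc zero) xs * f (suc zero)))

eps-select : (Δ : Coloring) (f : Fin 2 → ℕ) → f (Δ (+ 0)) ≡ eps Δ * f zero + (1 ∸ eps Δ) * f (suc zero)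
eps-select Δ f with Δ (+ 0) Fin.≟ zero
... | yes Δ0≡0 = trans (cong f Δ0≡0) (sym (trans (ℕₚ.+-identityʳ _) (ℕₚ.+-identityʳ (f zero))))
... | no Δ0≢0 with Δ (+ 0)
...   | zero     = contradiction refl Δ0≢0
...   | suc zero = sym (ℕₚ.+-identityʳ (f (suc zero)))

count-triples : {P : Pred (ℤ.ℤ × ℤ.ℤ × ℤ.ℤ) 0ℓ} (P? : U.Decidable P) (I J : List ℤ.ℤ) →
                count P? (triples I J J) ≡ sum (map (λ x → pairCount (λ y z → P? (x , y , z)) J) I)
count-triples P? I J = trans (count-concatMap P? _ I) (cong sum (map-cong row I))
  where
  row : ∀ x → count P? (concatMap (λ y → map (λ z → (x , y , z)) J) J) ≡ pairCount (λ y z → P? (x , y , z)) J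
  row x = trans (count-concatMap P? _ J) (cong sum (map-cong (λ y → count-map P? (λ z → (x , y , z)) J) J))

module _ (Δ : Coloring) where

  QPP-below-zero : ∀ {x y} → x ℤ.< + 0 → x ℤ.≤ y →
                   (λ z → QPP Δ (x , y , z)) ≐ (λ z → y ℤ.≤ z × Δ y ≡ Δ x × Δ z ≡ Δ x)
  QPP-below-zero {x} {y} x<0 x≤y =
      (λ (_ , y≤z , _ , e₁ , e₂) → y≤z , sym e₁ , sym (trans e₁ e₂))
    , (λ (y≤z , e₁ , e₂) → x≤y , y≤z , ℤₚ.<-≤-trans x+y<y y≤z , sym e₁ , trans e₁ (sym e₂))
    where
    x+y<y : x ℤ.+ y ℤ.< y
    x+y<y = subst (x ℤ.+ y ℤ.<_) (ℤₚ.+-identityˡ y) (ℤₚ.+-monoˡ-< y x<0)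

  QPP-at-zero : ∀ {y} → + 0 ℤ.≤ y →
                (λ z → QPP Δ (+ 0 , y , z)) ≐ (λ z → y ℤ.< z × Δ y ≡ Δ (+ 0) × Δ z ≡ Δ (+ 0))
  QPP-at-zero {y} 0≤y =
      (λ (_ , _ , 0+y<z , e₁ , e₂) → subst (ℤ._< _) (ℤₚ.+-identityˡ y) 0+y<z , sym e₁ , sym (trans e₁ e₂))
    , (λ (y<z , e₁ , e₂) →
         0≤y , ℤₚ.<⇒≤ y<z , subst (ℤ._< _) (sym (ℤₚ.+-identityˡ y)) y<z , sym e₁ , trans e₁ (sym e₂))

  pairCount-QPP-below-zero : ∀ {x L} → x ℤ.< + 0 → All (x ℤ.≤_) L → AllPairs ℤ._<_ L →
                             pairCount (λ y z → QPP? Δ (x , y , z)) L ≡ (colourCount Δ (Δ x) L + 1) C 2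
  pairCount-QPP-below-zero {x} {L} x<0 x≤L sorted = begin
    pairCount (λ y z → QPP? Δ (x , y , z)) L
      ≡⟨ pairCount-cong _ _ (All.map (QPP-below-zero x<0) x≤L) ⟩
    pairCount (λ y z → y ℤ.≤? z ×-dec (Δ y Fin.≟ Δ x ×-dec Δ z Fin.≟ Δ x)) L
      ≡⟨ pairCount-filter ℤ._≤?_ (λ y → Δ y Fin.≟ Δ x) L ⟩
    pairCount ℤ._≤?_ (filter (λ y → Δ y Fin.≟ Δ x) L)
      ≡⟨ pairCount-≤ (AllPairs.filter⁺ _ sorted) ⟩
    (colourCount Δ (Δ x) L + 1) C 2
      ∎
    where open ≡-Reasoning

  pairCount-QPP-zero : ∀ {L} → All (+ 0 ℤ.≤_) L → AllPairs ℤ._<_ L →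
                       pairCount (λ y z → QPP? Δ (+ 0 , y , z)) L
                         ≡ eps Δ * (count0 Δ L C 2) + (1 ∸ eps Δ) * ((length L ∸ count0 Δ L) C 2)
  pairCount-QPP-zero {L} 0≤L sorted = begin
    pairCount (λ y z → QPP? Δ (+ 0 , y , z)) L
      ≡⟨ pairCount-cong _ _ (All.map QPP-at-zero 0≤L) ⟩
    pairCount (λ y z → y ℤ.<? z ×-dec (Δ y Fin.≟ Δ (+ 0) ×-dec Δ z Fin.≟ Δ (+ 0))) L
      ≡⟨ pairCount-filter ℤ._<?_ (λ y → Δ y Fin.≟ Δ (+ 0)) L ⟩
    pairCount ℤ._<?_ (filter (λ y → Δ y Fin.≟ Δ (+ 0)) L)
      ≡⟨ pairCount-< (AllPairs.filter⁺ _ sorted) ⟩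
    colourCount Δ (Δ (+ 0)) L C 2
      ≡⟨ eps-select Δ (λ c → colourCount Δ c L C 2) ⟩
    eps Δ * (count0 Δ L C 2) + (1 ∸ eps Δ) * (colourCount Δ (suc zero) L C 2)
      ≡⟨ cong (λ m → eps Δ * (count0 Δ L C 2) + (1 ∸ eps Δ) * (m C 2)) (colourCount-one Δ L) ⟩
    eps Δ * (count0 Δ L C 2) + (1 ∸ eps Δ) * ((length L ∸ count0 Δ L) C 2)
      ∎
    where open ≡-Reasoning

  sum-pairCount-QPP-below-zero : ∀ {X L} → All (ℤ._< + 0) X → All (+ 0 ℤ.<_) L → AllPairs ℤ._<_ L →
    sum (map (λ x → pairCount (λ y z → QPP? Δ (x , y , z)) L) X)
      ≡ count0 Δ X * ((count0 Δ L + 1) C 2) + (length X ∸ count0 Δ X) * ((length L ∸ count0 Δ L + 1) C 2)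
  sum-pairCount-QPP-below-zero {X} {L} X<0 0<L sorted = begin
    sum (map (λ x → pairCount (λ y z → QPP? Δ (x , y , z)) L) X)
      ≡⟨ cong sum (map-cong-local (All.map row X<0)) ⟩
    sum (map (f ∘ Δ) X)
      ≡⟨ sum-map-colour Δ f X ⟩
    count0 Δ X * f zero + colourCount Δ (suc zero) X * f (suc zero)
      ≡⟨ cong₂ (λ m k → count0 Δ X * f zero + m * ((k + 1) C 2)) (colourCount-one Δ X) (colourCount-one Δ L) ⟩
    count0 Δ X * ((count0 Δ L + 1) C 2) + (length X ∸ count0 Δ X) * ((length L ∸ count0 Δ L + 1) C 2)
      ∎
    where
    open ≡-Reasoning
    f : Fin 2 → ℕ
    f c = (colourCount Δ c L + 1) C 2
    row : ∀ {x} → x ℤ.< + 0 → pairCount (λ y z → QPP? Δ (x , y , z)) L ≡ f (Δ x)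
    row x<0 = pairCount-QPP-below-zero x<0 (All.map (ℤₚ.<⇒≤ ∘ ℤₚ.<-trans x<0) 0<L) sorted

-- Matching on 2 ≤ t makes the
-- endpoints of [1 - t, -1] compute, so its length is suc t' by refl.
lemma4p4 : (t n : ℕ) → 2 ≤ t → t + 1 ≤ n → (Δ : Coloring) →
    NQPP t (n ∸ t) Δ ≡
      count0 Δ [ + 1 ℤ.- + t , -[1+ 0 ] ] * ((count0 Δ [ + 1 , + (n ∸ t) ] + 1) C 2)
      + (t ∸ 1 ∸ count0 Δ [ + 1 ℤ.- + t , -[1+ 0 ] ]) * (((n ∸ t) ∸ count0 Δ [ + 1 , + (n ∸ t) ] + 1) C 2)
      + eps Δ * (count0 Δ [ + 1 , + (n ∸ t) ] C 2)
      + (1 ∸ eps Δ) * (((n ∸ t) ∸ count0 Δ [ + 1 , + (n ∸ t) ]) C 2)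
lemma4p4 t@(suc (suc t')) n (s≤s (s≤s z≤n)) _ Δ = begin
  NQPP t N Δ                   ≡⟨ count-triples (QPP? Δ) X₀ L ⟩
  sum (map F X₀)               ≡⟨ cong (sum ∘ map F) ([,]-∷ʳ (+ 1 ℤ.- + t) -[1+ 0 ] ℤ.-≤+) ⟨
  sum (map F (X ∷ʳ + 0))       ≡⟨ sum-map-∷ʳ F X (+ 0) ⟩
  sum (map F X) + F (+ 0)      ≡⟨ cong₂ _+_ (sum-pairCount-QPP-below-zero Δ X<0 0<L L-sorted)
                                            (pairCount-QPP-zero Δ (All.map ℤₚ.<⇒≤ 0<L) L-sorted) ⟩
  shape (length X) (length L)  ≡⟨ cong₂ shape (length-[,] (+ 1 ℤ.- + t) -[1+ 0 ] refl)
                                              (length-[,] (+ 1) (+ N) (i+1-1≡i (+ N))) ⟩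
  shape (suc t') N             ≡⟨ ℕₚ.+-assoc (a * ((q + 1) C 2) + (suc t' ∸ a) * ((N ∸ q + 1) C 2)) _ _ ⟨
  _                            ∎
  where
  open ≡-Reasoning
  N : ℕ
  N = n ∸ t
  L X X₀ : List ℤ.ℤ
  L = [ + 1 , + N ]
  X = [ + 1 ℤ.- + t , -[1+ 0 ] ]
  X₀ = [ + 1 ℤ.- + t , + 0 ]
  F : ℤ.ℤ → ℕ
  F x = pairCount (λ y z → QPP? Δ (x , y , z)) L
  q a : ℕ
  q = count0 Δ L
  a = count0 Δ X
  shape : ℕ → ℕ → ℕ
  shape ℓX ℓL = (a * ((q + 1) C 2) + (ℓX ∸ a) * ((ℓL ∸ q + 1) C 2))
              + (eps Δ * (q C 2) + (1 ∸ eps Δ) * ((ℓL ∸ q) C 2))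
  L-sorted : AllPairs ℤ._<_ L
  L-sorted = [,]-sorted (+ 1) (+ N)
  0<L : All (+ 0 ℤ.<_) L
  0<L = All.map ℤₚ.suc[i]≤j⇒i<j ([,]-lower (+ 1) (+ N))
  X<0 : All (ℤ._< + 0) X
  X<0 = All.map (λ x≤-1 → ℤₚ.≤-<-trans x≤-1 ℤ.-<+) ([,]-upper (+ 1 ℤ.- + t) -[1+ 0 ])
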